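{- For every input $\mathcal I$ of online Min-Sum Set Cover there exists an offline algorithm $\mathrm{Off}^*$ that is MTF-based and satisfies $\mathrm{Off}^*(\mathcal I)\le 4\cdot\mathrm{OPT}(\mathcal I)$.
   Context: Online Min-Sum Set Cover (MSSC). Let $\mathcal U$ be a universe of $n$ elements. A permutation is a bijection $\pi:\mathcal U\to\{1,\dots,n\}$, where $\pi(z)$ is the list position of $z$. An input $\mathcal I$ consists of an initial permutation $\pi_0$ and a sequence of nonempty sets $R_1,\dots,R_m\subseteq\mathcal U$. In step $t$, an algorithm holding permutation $\pi_{t-1}$ pays the access cost $\min_{z\in R_t}\pi_{t-1}(z)$. It then picks $\pi_t$ and pays $d(\pi_{t-1},\pi_t)$, the minimum number of adjacent swaps turning $\pi_{t-1}$ into $\pi_t$ (equivalently, the number of inversions between them). $A(\mathcal I)$ is the total cost of algorithm $A$. $\mathrm{OPT}(\mathcal I)$ is the minimum total cost over all offline algorithms starting from $\pi_0$. An algorithm is MTF-based if, in response to each request $R_t$ and after paying the access cost, it chooses exactly one element of $R_t$, moves it to the first position (shifting the elements that preceded it back by one position, at cost equal to its previous position minus 1), and makes no other changes to its list. -}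

module Defs where

open import Data.Nat using (ℕ; zero; suc; _+_; _⊓_)
open import Data.Bool using (Bool; true; false; if_then_else_)
open import Data.Fin using (Fin; toℕ; _<?_)
open import Data.Fin.Subset using (Subset; _∈_; Nonempty)
open import Data.Nat.ListAction using (sum)
open import Data.List using (List; map; allFin; foldr; cartesianProductWith)
open import Data.Vec using (Vec; []; _∷_; lookup)
open import Data.Product using (Σ; _×_)
open import Relation.Binary.PropositionalEquality using (_≡_; _≢_)
open import Relation.Nullary.Decidable using (⌊_⌋)
open import Function.Definitions using (Injective)
open import Data.Fin using (_<_)

-- A permutation assigns to each element z its list
-- position pos z ∈ Fin n, 0-based (paper position = toℕ (pos z) + 1).
-- An injective map Fin n → Fin n is exactly a bijection.
record Perm (n : ℕ) : Set where
  field
    pos : Fin n → Fin n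
    pos-injective : Injective _≡_ _≡_ pos
open Perm public

-- Access cost  min_{z ∈ R} π(z)  (1-based positions).  Starting the fold at n
-- is harmless since every 1-based position is ≤ n and R is nonempty.
accessCost : ∀ {n} → Perm n → Subset n → ℕ
accessCost {n} π R =
  foldr (λ z acc → if lookup R z then (suc (toℕ (pos π z)) ⊓ acc) else acc) n (allFin n)

-- d(π, σ): number of inversions = number of ordered pairs (x , y) with
-- π(x) < π(y) and σ(y) < σ(x)  (= minimum number of adjacent swaps).
inversions : ∀ {n} → Perm n → Perm n → ℕ
inversions {n} π σ =
  sum (cartesianProductWith
        (λ x y → if ⌊ pos π x <? pos π y ⌋ then (if ⌊ pos σ y <? pos σ x ⌋ then 1 else 0) else 0)
        (allFin n) (allFin n))

totalCost : ∀ {n m} → Perm n → Vec (Subset n) m → Vec (Perm n) m → ℕ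
totalCost π [] [] = 0
totalCost π (R ∷ Rs) (π′ ∷ πs) = accessCost π R + inversions π π′ + totalCost π′ Rs πs

MoveToFront : ∀ {n} → Perm n → Fin n → Perm n → Set
MoveToFront {n} π z π′ =
  (toℕ (pos π′ z) ≡ 0) ×
  ((y : Fin n) → y ≢ z → pos π y < pos π z → toℕ (pos π′ y) ≡ suc (toℕ (pos π y))) ×
  ((y : Fin n) → y ≢ z → pos π z < pos π y → toℕ (pos π′ y) ≡ toℕ (pos π y))

MTFStep : ∀ {n} → Perm n → Subset n → Perm n → Set
MTFStep {n} π R π′ = Σ (Fin n) λ z → (z ∈ R) × MoveToFront π z π′

data MTFBased {n : ℕ} : ∀ {m} → Perm n → Vec (Subset n) m → Vec (Perm n) m → Set where
  mtf-[] : ∀ {π} → MTFBased π [] []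
  mtf-∷  : ∀ {m π π′ R} {Rs : Vec (Subset n) m} {πs : Vec (Perm n) m} →
           MTFStep π R π′ → MTFBased π′ Rs πs → MTFBased π (R ∷ Rs) (π′ ∷ πs)

data AllNonempty {n : ℕ} : ∀ {m} → Vec (Subset n) m → Set where
  ne-[] : AllNonempty []
  ne-∷  : ∀ {m R} {Rs : Vec (Subset n) m} → Nonempty R → AllNonempty Rs → AllNonempty (R ∷ Rs)

{-# OPTIONS --safe #-}
module Submission where

-- Fix an optimal run π₀ = ρ₀, ρ₁, …, ρₘ and, on each request R, move to the front the element z
-- of R that the reference list ρ reaches first. Take Φ = 2·d(σ, ρ) as potential, σ being our list.
-- With 1-based positions, if A elements precede z in both lists and B only in σ, then
-- σ(z) = A + B + 1, so our access and move costs total at most 1 + 2(A + B); moving z to the front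
-- changes d(σ, ρ) by A − B, and the reference's move of cost k by at most k. So our cost plus the
-- increase of Φ is at most 1 + 4A + 2k, which is at most 4 times the reference's cost ρ(z) + k as
-- A < ρ(z). Since Φ starts at 0, the total is at most 4·OPT. An optimal run exists because runs,
-- coded as vectors of position vectors, can be enumerated.

open import Defs
open import Data.Bool using (Bool; true; false; if_then_else_)
open import Data.Fin using (Fin; zero; suc; toℕ; fromℕ<; punchOut) renaming (_<_ to _<ᶠ_)
open import Data.Fin.Properties using (_≟_; _<?_)
import Data.Fin.Properties as Finₚ
open import Data.Fin.Subset using (Subset; Nonempty) renaming (_∈_ to _∈ˢ_)
open import Data.List as List using (List; allFin; foldr; cartesianProductWith)
open import Data.List.Extrema.Nat using (argmin; f[argmin]≤f[xs])
open import Data.List.Membership.Propositional using (_∈_)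
open import Data.List.Membership.Propositional.Properties using (∈-allFin; ∈-cartesianProductWith⁺)
open import Data.List.Properties using (map-tabulate; foldr-cong)
open import Data.List.Relation.Unary.All as All using ()
open import Data.List.Relation.Unary.Any using (here; there)
open import Data.Nat using (ℕ; zero; suc; _+_; _*_; _≤_; _<_; _⊓_; z≤n; s≤s; s≤s⁻¹)
open import Data.Nat.ListAction using () renaming (sum to sumˡ)
open import Data.Nat.ListAction.Properties using (sum-++)
open import Data.Nat.Properties hiding (_≟_; _<?_; <-cmp)
import Data.Nat.Properties as ℕₚ
open import Algebra.Properties.CommutativeMonoid.Sum +-0-commutativeMonoid
  using (sum; sum-syntax; sum-cong-≗; sum-replicate-zero; ∑-distrib-+; ∑-comm)
open import Data.Nat.Tactic.RingSolver using (solve-∀)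
open import Data.Product using (Σ; ∃; _,_; _×_; proj₁; proj₂)
open import Data.Sum using (_⊎_; inj₁; inj₂)
open import Data.Vec as Vec using (Vec; []; _∷_; lookup; tabulate; map; replicate)
open import Data.Vec.Properties using (lookup∘tabulate; []=⇒lookup; lookup⇒[]=)
open import Data.Vec.Relation.Binary.Pointwise.Inductive using (Pointwise; []; _∷_)
open import Function using (_∘_; id)
open import Function.Definitions using (Injective)
open import Relation.Binary.Definitions using (tri<; tri≈; tri>)
open import Relation.Binary.PropositionalEquality
open import Relation.Nullary using (Dec; yes; no; ¬_; contradiction)
open import Relation.Nullary.Decidable using (⌊_⌋; _→-dec_)

private
  variable
    n m : ℕ

𝟙 : ∀ {P : Set} → Dec P → ℕ
𝟙 d = if ⌊ d ⌋ then 1 else 0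

𝟙-yes : ∀ {P : Set} (d : Dec P) → P → 𝟙 d ≡ 1
𝟙-yes (yes _) _ = refl
𝟙-yes (no ¬p) p = contradiction p ¬p

𝟙-no : ∀ {P : Set} (d : Dec P) → ¬ P → 𝟙 d ≡ 0
𝟙-no (yes p) ¬p = contradiction p ¬p
𝟙-no (no _) _ = refl

𝟙≤1 : ∀ {P : Set} (d : Dec P) → 𝟙 d ≤ 1
𝟙≤1 (yes _) = ≤-refl
𝟙≤1 (no _) = z≤n

𝟙*≤ : ∀ {P : Set} (d : Dec P) k → 𝟙 d * k ≤ k
𝟙*≤ (yes _) k = ≤-reflexive (+-identityʳ k)
𝟙*≤ (no _) k = z≤n

𝟙-<-suc : ∀ m k → 𝟙 (m ℕₚ.<? suc k) ≡ 𝟙 (m ℕₚ.<? k) + 𝟙 (m ℕₚ.≟ k)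
𝟙-<-suc m k with ℕₚ.<-cmp m k
... | tri< m<k m≢k _
  rewrite 𝟙-yes (m ℕₚ.<? suc k) (m<n⇒m<1+n m<k) | 𝟙-yes (m ℕₚ.<? k) m<k
        | 𝟙-no (m ℕₚ.≟ k) m≢k = refl
... | tri≈ m≮k refl _
  rewrite 𝟙-yes (m ℕₚ.<? suc m) ≤-refl | 𝟙-no (m ℕₚ.<? m) m≮k
        | 𝟙-yes (m ℕₚ.≟ m) refl = refl
... | tri> m≮k m≢k k<m
  rewrite 𝟙-no (m ℕₚ.<? suc k) (<⇒≱ k<m ∘ s≤s⁻¹) | 𝟙-no (m ℕₚ.<? k) m≮k
        | 𝟙-no (m ℕₚ.≟ k) m≢k = refl

if-then-else-0 : ∀ b k → (if b then k else 0) ≡ (if b then 1 else 0) * k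
if-then-else-0 true k = sym (+-identityʳ k)
if-then-else-0 false k = refl

∑-mono-≤ : {f g : Fin n → ℕ} → (∀ i → f i ≤ g i) → sum f ≤ sum g
∑-mono-≤ {zero} f≤g = z≤n
∑-mono-≤ {suc n} f≤g = +-mono-≤ (f≤g zero) (∑-mono-≤ (f≤g ∘ suc))

∑∑-distrib-+ : ∀ {m} (f g : Fin m → Fin n → ℕ) →
  ∑[ x < m ] ∑[ y < n ] (f x y + g x y) ≡ ∑[ x < m ] ∑[ y < n ] f x y + ∑[ x < m ] ∑[ y < n ] g x y
∑∑-distrib-+ {n} {m} f g =
  trans (sum-cong-≗ {m} (λ x → ∑-distrib-+ (f x) (g x))) (∑-distrib-+ (λ x → sum (f x)) (λ x → sum (g x)))

∑-zero : {f : Fin n → ℕ} → (∀ i → f i ≡ 0) → sum f ≡ 0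
∑-zero {n} f≗0 = trans (sum-cong-≗ f≗0) (sum-replicate-zero n)

∑-single : {f : Fin n → ℕ} (j : Fin n) → (∀ i → i ≢ j → f i ≡ 0) → sum f ≡ f j
∑-single {suc n} {f} zero f≗0 = trans (cong (f zero +_) (∑-zero (λ i → f≗0 (suc i) λ ()))) (+-identityʳ _)
∑-single {suc n} (suc j) f≗0 =
  cong₂ _+_ (f≗0 zero λ ()) (∑-single j (λ i i≢j → f≗0 (suc i) (i≢j ∘ Finₚ.suc-injective)))

∑-indicator : (f : Fin n → ℕ) (j : Fin n) → ∑[ i < n ] (𝟙 (i ≟ j) * f i) ≡ f j
∑-indicator f j = trans (∑-single j (λ i i≢j → cong (_* f i) (𝟙-no (i ≟ j) i≢j)))
                        (trans (cong (_* f j) (𝟙-yes (j ≟ j) refl)) (+-identityʳ (f j)))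

sum-tabulate : (f : Fin n → ℕ) → sumˡ (List.tabulate f) ≡ sum f
sum-tabulate {zero} f = refl
sum-tabulate {suc n} f = cong (f zero +_) (sum-tabulate (f ∘ suc))

sum-map-allFin : (f : Fin n → ℕ) → sumˡ (List.map f (allFin n)) ≡ sum f
sum-map-allFin f = trans (cong sumˡ (map-tabulate id f)) (sum-tabulate f)

sum-cartesianProductWith : ∀ {A B : Set} (g : A → B → ℕ) xs ys →
  sumˡ (cartesianProductWith g xs ys) ≡ sumˡ (List.map (λ x → sumˡ (List.map (g x) ys)) xs)
sum-cartesianProductWith g List.[] ys = refl
sum-cartesianProductWith g (x List.∷ xs) ys =
  trans (sum-++ (List.map (g x) ys) _) (cong (sumˡ (List.map (g x) ys) +_) (sum-cartesianProductWith g xs ys))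

injective⇒surjective : {f : Fin n → Fin n} → Injective _≡_ _≡_ f → ∀ y → ∃ λ x → f x ≡ y
injective⇒surjective {suc n} {f} f-inj y with Finₚ.any? (λ x → f x ≟ y)
... | yes hit = hit
... | no miss = contradiction (Finₚ.injective⇒≤ g-inj) (<-irrefl refl)
  where
  g : Fin (suc n) → Fin n
  g x = punchOut {i = y} (λ y≡fx → miss (x , sym y≡fx))
  g-inj : Injective _≡_ _≡_ g
  g-inj = f-inj ∘ Finₚ.punchOut-injective {i = y} _ _

precedes : Perm n → Fin n → Fin n → ℕ
precedes π x y = 𝟙 (pos π x <? pos π y)

module _ (σ : Perm n) where

  ∑-position≡ : ∀ k → k < n → ∑[ x < n ] 𝟙 (toℕ (pos σ x) ℕₚ.≟ k) ≡ 1
  ∑-position≡ k k<n with x , σx≡k′ ← injective⇒surjective (pos-injective σ) (fromℕ< k<n) =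
    trans (∑-single x only-x) (𝟙-yes (toℕ (pos σ x) ℕₚ.≟ k) σx≡k)
    where
    σx≡k : toℕ (pos σ x) ≡ k
    σx≡k = trans (cong toℕ σx≡k′) (Finₚ.toℕ-fromℕ< k<n)
    only-x : ∀ y → y ≢ x → 𝟙 (toℕ (pos σ y) ℕₚ.≟ k) ≡ 0
    only-x y y≢x = 𝟙-no (toℕ (pos σ y) ℕₚ.≟ k)
      (λ σy≡k → y≢x (pos-injective σ (Finₚ.toℕ-injective (trans σy≡k (sym σx≡k)))))

  ∑-position< : ∀ k → k ≤ n → ∑[ x < n ] 𝟙 (toℕ (pos σ x) ℕₚ.<? k) ≡ k
  ∑-position< zero _ = ∑-zero (λ x → 𝟙-no (toℕ (pos σ x) ℕₚ.<? 0) λ ())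
  ∑-position< (suc k) k<n = begin
    ∑[ x < n ] 𝟙 (toℕ (pos σ x) ℕₚ.<? suc k)
      ≡⟨ sum-cong-≗ (λ x → 𝟙-<-suc (toℕ (pos σ x)) k) ⟩
    ∑[ x < n ] (𝟙 (toℕ (pos σ x) ℕₚ.<? k) + 𝟙 (toℕ (pos σ x) ℕₚ.≟ k))
      ≡⟨ ∑-distrib-+ (λ x → 𝟙 (toℕ (pos σ x) ℕₚ.<? k)) (λ x → 𝟙 (toℕ (pos σ x) ℕₚ.≟ k)) ⟩
    ∑[ x < n ] 𝟙 (toℕ (pos σ x) ℕₚ.<? k) + ∑[ x < n ] 𝟙 (toℕ (pos σ x) ℕₚ.≟ k)
      ≡⟨ cong₂ _+_ (∑-position< k (<⇒≤ k<n)) (∑-position≡ k k<n) ⟩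
    k + 1
      ≡⟨ +-comm k 1 ⟩
    suc k ∎
    where open ≡-Reasoning

  ∑-predecessors : (z : Fin n) → ∑[ x < n ] precedes σ x z ≡ toℕ (pos σ z)
  ∑-predecessors z = ∑-position< (toℕ (pos σ z)) (<⇒≤ (Finₚ.toℕ<n (pos σ z)))

module _ {A : Set} (p : A → Bool) (g : A → ℕ) where

  private
    step : A → ℕ → ℕ
    step z acc = if p z then g z ⊓ acc else acc

  foldr-⊓-≤ : ∀ {z} b xs → z ∈ xs → p z ≡ true → foldr step b xs ≤ g z
  foldr-⊓-≤ b (x List.∷ xs) (here refl) pz rewrite pz = m⊓n≤m _ _
  foldr-⊓-≤ b (x List.∷ xs) (there z∈xs) pz with p x
  ... | true = ≤-trans (m⊓n≤n _ _) (foldr-⊓-≤ b xs z∈xs pz)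
  ... | false = foldr-⊓-≤ b xs z∈xs pz

  foldr-⊓-attained : ∀ b xs → foldr step b xs ≡ b ⊎ ∃ λ z → p z ≡ true × foldr step b xs ≡ g z
  foldr-⊓-attained b List.[] = inj₁ refl
  foldr-⊓-attained b (x List.∷ xs) with p x in px | foldr-⊓-attained b xs
  ... | false | ih = ih
  ... | true | ih with ≤-total (g x) (foldr step b xs)
  ...   | inj₁ gx≤ = inj₂ (x , px , m≤n⇒m⊓n≡m gx≤)
  ...   | inj₂ ≤gx with ih
  ...     | inj₁ ≡b = inj₁ (trans (m≥n⇒m⊓n≡n ≤gx) ≡b)
  ...     | inj₂ (z , pz , ≡gz) = inj₂ (z , pz , trans (m≥n⇒m⊓n≡n ≤gx) ≡gz)

module _ {n} (π : Perm n) (R : Subset n) where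

  accessCost-≤ : ∀ {z} → z ∈ˢ R → accessCost π R ≤ suc (toℕ (pos π z))
  accessCost-≤ {z} z∈R =
    foldr-⊓-≤ (lookup R) (suc ∘ toℕ ∘ pos π) n (allFin n) (∈-allFin z) ([]=⇒lookup z∈R)

  accessCost-attained : Nonempty R → ∃ λ z → z ∈ˢ R × accessCost π R ≡ suc (toℕ (pos π z))
  accessCost-attained (z₀ , z₀∈R) with foldr-⊓-attained (lookup R) (suc ∘ toℕ ∘ pos π) n (allFin n)
  ... | inj₂ (z , Rz , cost≡) = z , lookup⇒[]= z R Rz , cost≡
  ... | inj₁ cost≡n = z₀ , z₀∈R , ≤-antisym (accessCost-≤ z₀∈R)
                                    (subst (_ ≤_) (sym cost≡n) (Finₚ.toℕ<n (pos π z₀)))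

toℕ-punchOut-< : ∀ {i j : Fin (suc n)} (i≢j : i ≢ j) → j <ᶠ i → toℕ (punchOut i≢j) ≡ toℕ j
toℕ-punchOut-< {suc n} {suc i} {zero} i≢j j<i = refl
toℕ-punchOut-< {suc n} {suc i} {suc j} i≢j j<i = cong suc (toℕ-punchOut-< (i≢j ∘ cong suc) (s≤s⁻¹ j<i))

toℕ-punchOut-> : ∀ {i j : Fin (suc n)} (i≢j : i ≢ j) → i <ᶠ j → suc (toℕ (punchOut i≢j)) ≡ toℕ j
toℕ-punchOut-> {_} {zero} {suc j} i≢j i<j = refl
toℕ-punchOut-> {suc n} {suc i} {suc j} i≢j i<j = cong suc (toℕ-punchOut-> (i≢j ∘ cong suc) (s≤s⁻¹ i<j))

module _ (σ : Perm (suc n)) (z : Fin (suc n)) where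

  private
    pos≢ : ∀ {y} → y ≢ z → pos σ z ≢ pos σ y
    pos≢ y≢z = y≢z ∘ sym ∘ pos-injective σ

  -- punchOut (pos σ z) closes the gap left by z, and suc then shifts everything back by one.
  frontPos : Fin (suc n) → Fin (suc n)
  frontPos y with y ≟ z
  ... | yes _ = zero
  ... | no y≢z = suc (punchOut (pos≢ y≢z))

  frontPos-self : frontPos z ≡ zero
  frontPos-self with z ≟ z
  ... | yes _ = refl
  ... | no z≢z = contradiction refl z≢z

  frontPos-other : ∀ {y} (y≢z : y ≢ z) → frontPos y ≡ suc (punchOut (pos≢ y≢z))
  frontPos-other {y} y≢z with y ≟ z
  ... | yes y≡z = contradiction y≡z y≢z
  ... | no _ = cong suc (Finₚ.punchOut-cong (pos σ z) refl)

  frontPos-injective : Injective _≡_ _≡_ frontPos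
  frontPos-injective {x} {y} eq with x ≟ z | y ≟ z
  ... | yes x≡z | yes y≡z = trans x≡z (sym y≡z)
  ... | yes _ | no _ with () ← eq
  ... | no _ | yes _ with () ← eq
  ... | no x≢z | no y≢z =
    pos-injective σ (Finₚ.punchOut-injective (pos≢ x≢z) (pos≢ y≢z) (Finₚ.suc-injective eq))

moveToFront : Perm n → Fin n → Perm n
moveToFront {suc n} σ z = record { pos = frontPos σ z ; pos-injective = frontPos-injective σ z }

moveToFront-correct : (σ : Perm n) (z : Fin n) → MoveToFront σ z (moveToFront σ z)
moveToFront-correct {suc n} σ z = cong toℕ (frontPos-self σ z) , before , after
  where
  before : ∀ y → y ≢ z → pos σ y <ᶠ pos σ z → toℕ (frontPos σ z y) ≡ suc (toℕ (pos σ y))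
  before y y≢z y<z = trans (cong toℕ (frontPos-other σ z y≢z)) (cong suc (toℕ-punchOut-< _ y<z))
  after : ∀ y → y ≢ z → pos σ z <ᶠ pos σ y → toℕ (frontPos σ z y) ≡ toℕ (pos σ y)
  after y y≢z z<y = trans (cong toℕ (frontPos-other σ z y≢z)) (toℕ-punchOut-> _ z<y)

moveToFront-first : (σ : Perm n) (z x : Fin n) → ¬ (pos (moveToFront σ z) x <ᶠ pos (moveToFront σ z) z)
moveToFront-first {suc n} σ z x x<z rewrite frontPos-self σ z with () ← x<z

moveToFront-reflects-< : (σ : Perm n) (z : Fin n) {x y : Fin n} → x ≢ z → y ≢ z →
  pos (moveToFront σ z) x <ᶠ pos (moveToFront σ z) y → pos σ x <ᶠ pos σ y
moveToFront-reflects-< {suc n} σ z {x} {y} x≢z y≢z x<y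
  rewrite frontPos-other σ z x≢z | frontPos-other σ z y≢z with pos σ x <? pos σ y
... | yes σx<σy = σx<σy
... | no σx≮σy =
  contradiction (Finₚ.punchOut-mono-≤ {i = pos σ z} _ _ (≮⇒≥ σx≮σy)) (<⇒≱ (s≤s⁻¹ x<y))

inverted : Perm n → Perm n → Fin n → Fin n → ℕ
inverted π σ x y = precedes π x y * precedes σ y x

inversions-∑ : (π σ : Perm n) → inversions π σ ≡ ∑[ x < n ] ∑[ y < n ] inverted π σ x y
inversions-∑ {n} π σ = begin
  inversions π σ
    ≡⟨ sum-cartesianProductWith g (allFin n) (allFin n) ⟩
  sumˡ (List.map (λ x → sumˡ (List.map (g x) (allFin n))) (allFin n))
    ≡⟨ sum-map-allFin (λ x → sumˡ (List.map (g x) (allFin n))) ⟩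
  ∑[ x < n ] sumˡ (List.map (g x) (allFin n))
    ≡⟨ sum-cong-≗ {n} (λ x → trans (sum-map-allFin (g x)) (sum-cong-≗ {n} (g≡inverted x))) ⟩
  ∑[ x < n ] ∑[ y < n ] inverted π σ x y ∎
  where
  open ≡-Reasoning
  g : Fin n → Fin n → ℕ
  g x y = if ⌊ pos π x <? pos π y ⌋ then precedes σ y x else 0
  g≡inverted : ∀ x y → g x y ≡ inverted π σ x y
  g≡inverted x y = if-then-else-0 ⌊ pos π x <? pos π y ⌋ (precedes σ y x)

module _ (π : Perm n) where

  precedes-irrefl : ∀ x → precedes π x x ≡ 0
  precedes-irrefl x = 𝟙-no (pos π x <? pos π x) (Finₚ.<-irrefl refl)

  precedes-total : ∀ {x y} → x ≢ y → precedes π x y + precedes π y x ≡ 1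
  precedes-total {x} {y} x≢y with Finₚ.<-cmp (pos π x) (pos π y)
  ... | tri< x<y _ y≮x rewrite 𝟙-yes (pos π x <? pos π y) x<y | 𝟙-no (pos π y <? pos π x) y≮x = refl
  ... | tri≈ _ πx≡πy _ = contradiction (pos-injective π πx≡πy) x≢y
  ... | tri> x≮y _ y<x rewrite 𝟙-no (pos π x <? pos π y) x≮y | 𝟙-yes (pos π y <? pos π x) y<x = refl

module _ (π σ : Perm n) where

  inverted-irrefl : ∀ x → inverted π σ x x ≡ 0
  inverted-irrefl x = cong (_* precedes σ x x) (precedes-irrefl π x)

  inverted-≤ˡ : ∀ x y → inverted π σ x y ≤ precedes π x y
  inverted-≤ˡ x y = begin
    inverted π σ x y                         ≡⟨ *-comm (precedes π x y) _ ⟩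
    precedes σ y x * precedes π x y ≤⟨ 𝟙*≤ (pos σ y <? pos σ x) _ ⟩
    precedes π x y                   ∎
    where open ≤-Reasoning

  inverted-yes : ∀ {x y} → pos π x <ᶠ pos π y → inverted π σ x y ≡ precedes σ y x
  inverted-yes {x} {y} πx<πy =
    trans (cong (_* precedes σ y x) (𝟙-yes (pos π x <? pos π y) πx<πy)) (+-identityʳ _)

  inverted-no : ∀ {x y} → ¬ (pos π x <ᶠ pos π y) → inverted π σ x y ≡ 0
  inverted-no {x} {y} πx≮πy = cong (_* precedes σ y x) (𝟙-no (pos π x <? pos π y) πx≮πy)

  inverted-≤ʳ : ∀ x y → inverted π σ x y ≤ precedes σ y x
  inverted-≤ʳ x y = 𝟙*≤ (pos π x <? pos π y) _

inverted-triangle : (π ρ σ : Perm n) → ∀ x y → inverted π σ x y ≤ inverted π ρ x y + inverted ρ σ x y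
inverted-triangle π ρ σ x y with Finₚ.<-cmp (pos π x) (pos π y)
... | tri≈ πx≮πy _ _ = ≤-trans (≤-reflexive (inverted-no π σ πx≮πy)) z≤n
... | tri> πx≮πy _ _ = ≤-trans (≤-reflexive (inverted-no π σ πx≮πy)) z≤n
... | tri< πx<πy _ _ with Finₚ.<-cmp (pos ρ x) (pos ρ y)
...   | tri< ρx<ρy _ _ = begin
  inverted π σ x y                      ≡⟨ inverted-yes π σ πx<πy ⟩
  precedes σ y x                ≡⟨ inverted-yes ρ σ ρx<ρy ⟨
  inverted ρ σ x y                      ≤⟨ m≤n+m _ _ ⟩
  inverted π ρ x y + inverted ρ σ x y   ∎
  where open ≤-Reasoning
...   | tri≈ _ ρx≡ρy _ = contradiction (cong (pos π) (pos-injective ρ ρx≡ρy)) (Finₚ.<⇒≢ πx<πy)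
...   | tri> _ _ ρy<ρx = begin
  inverted π σ x y                      ≤⟨ inverted-≤ʳ π σ x y ⟩
  precedes σ y x                ≤⟨ 𝟙≤1 (pos σ y <? pos σ x) ⟩
  1                                     ≡⟨ trans (inverted-yes π ρ πx<πy)
                                                 (𝟙-yes (pos ρ y <? pos ρ x) ρy<ρx) ⟨
  inverted π ρ x y                      ≤⟨ m≤m+n _ _ ⟩
  inverted π ρ x y + inverted ρ σ x y   ∎
  where open ≤-Reasoning

inversions-triangle : (π ρ σ : Perm n) → inversions π σ ≤ inversions π ρ + inversions ρ σ
inversions-triangle {n} π ρ σ = begin
  inversions π σ
    ≡⟨ inversions-∑ π σ ⟩
  ∑[ x < n ] ∑[ y < n ] inverted π σ x y
    ≤⟨ ∑-mono-≤ (λ x → ∑-mono-≤ (inverted-triangle π ρ σ x)) ⟩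
  ∑[ x < n ] ∑[ y < n ] (inverted π ρ x y + inverted ρ σ x y)
    ≡⟨ ∑∑-distrib-+ (inverted π ρ) (inverted ρ σ) ⟩
  ∑[ x < n ] ∑[ y < n ] inverted π ρ x y + ∑[ x < n ] ∑[ y < n ] inverted ρ σ x y
    ≡⟨ cong₂ _+_ (inversions-∑ π ρ) (inversions-∑ ρ σ) ⟨
  inversions π ρ + inversions ρ σ ∎
  where open ≤-Reasoning

inversions-refl : (π : Perm n) → inversions π π ≡ 0
inversions-refl {n} π = trans (inversions-∑ π π) (∑-zero (λ x → ∑-zero (λ y → inverted-refl x y)))
  where
  inverted-refl : ∀ x y → inverted π π x y ≡ 0
  inverted-refl x y with Finₚ.<-cmp (pos π x) (pos π y)
  ... | tri< πx<πy _ πy≮πx = trans (inverted-yes π π πx<πy) (𝟙-no (pos π y <? pos π x) πy≮πx)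
  ... | tri≈ πx≮πy _ _ = inverted-no π π πx≮πy
  ... | tri> πx≮πy _ _ = inverted-no π π πx≮πy

inversions-cong : {π π′ σ σ′ : Perm n} → pos π ≗ pos π′ → pos σ ≗ pos σ′ →
  inversions π σ ≡ inversions π′ σ′
inversions-cong {n} {π} {π′} {σ} {σ′} π≗π′ σ≗σ′ = begin
  inversions π σ                            ≡⟨ inversions-∑ π σ ⟩
  ∑[ x < n ] ∑[ y < n ] inverted π σ x y     ≡⟨ sum-cong-≗ {n} (λ x → sum-cong-≗ {n} (inverted-cong x)) ⟩
  ∑[ x < n ] ∑[ y < n ] inverted π′ σ′ x y   ≡⟨ inversions-∑ π′ σ′ ⟨
  inversions π′ σ′                          ∎
  where
  open ≡-Reasoning
  𝟙< : Fin n → Fin n → ℕ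
  𝟙< i j = 𝟙 (i <? j)
  inverted-cong : ∀ x y → inverted π σ x y ≡ inverted π′ σ′ x y
  inverted-cong x y = cong₂ _*_ (cong₂ 𝟙< (π≗π′ x) (π≗π′ y)) (cong₂ 𝟙< (σ≗σ′ y) (σ≗σ′ x))

commonPredecessors : Perm n → Perm n → Fin n → ℕ
commonPredecessors {n} σ π z = ∑[ y < n ] (precedes σ y z * precedes π y z)

invertedPredecessors : Perm n → Perm n → Fin n → ℕ
invertedPredecessors {n} σ π z = ∑[ x < n ] inverted σ π x z

module _ (σ π : Perm n) (z : Fin n) where

  predecessors-split : toℕ (pos σ z) ≡ commonPredecessors σ π z + invertedPredecessors σ π z
  predecessors-split = begin
    toℕ (pos σ z)
      ≡⟨ ∑-predecessors σ z ⟨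
    ∑[ x < n ] precedes σ x z
      ≡⟨ sum-cong-≗ {n} split ⟩
    ∑[ x < n ] (precedes σ x z * precedes π x z + inverted σ π x z)
      ≡⟨ ∑-distrib-+ (λ x → precedes σ x z * precedes π x z) (λ x → inverted σ π x z) ⟩
    commonPredecessors σ π z + invertedPredecessors σ π z ∎
    where
    open ≡-Reasoning
    split : ∀ x → precedes σ x z ≡ precedes σ x z * precedes π x z + inverted σ π x z
    split x with x ≟ z
    ... | yes refl = trans (precedes-irrefl σ x)
      (sym (cong₂ _+_ (cong (_* precedes π x x) (precedes-irrefl σ x)) (inverted-irrefl σ π x)))
    ... | no x≢z = begin
      precedes σ x z                                        ≡⟨ *-identityʳ _ ⟨
      precedes σ x z * 1                                    ≡⟨ cong (precedes σ x z *_) (precedes-total π x≢z) ⟨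
      precedes σ x z * (precedes π x z + precedes π z x)    ≡⟨ *-distribˡ-+ (precedes σ x z) _ _ ⟩
      precedes σ x z * precedes π x z + inverted σ π x z    ∎

  commonPredecessors-≤ : commonPredecessors σ π z ≤ toℕ (pos π z)
  commonPredecessors-≤ = begin
    commonPredecessors σ π z             ≤⟨ ∑-mono-≤ (λ y → 𝟙*≤ (pos σ y <? pos σ z) _) ⟩
    ∑[ y < n ] precedes π y z    ≡⟨ ∑-predecessors π z ⟩
    toℕ (pos π z)                        ∎
    where open ≤-Reasoning

module _ (σ : Perm n) (z : Fin n) where

  private
    σ′ = moveToFront σ z

  inverted-moveToFront : ∀ x {y} → y ≢ z → inverted σ σ′ x y ≡ 0
  inverted-moveToFront x {y} y≢z with Finₚ.<-cmp (pos σ x) (pos σ y)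
  ... | tri≈ σx≮σy _ _ = inverted-no σ σ′ σx≮σy
  ... | tri> σx≮σy _ _ = inverted-no σ σ′ σx≮σy
  ... | tri< σx<σy _ σy≮σx =
    trans (inverted-yes σ σ′ σx<σy) (𝟙-no (pos σ′ y <? pos σ′ x) σ′y≮σ′x)
    where
    σ′y≮σ′x : ¬ (pos σ′ y <ᶠ pos σ′ x)
    σ′y≮σ′x with x ≟ z
    ... | yes refl = moveToFront-first σ z y
    ... | no x≢z = σy≮σx ∘ moveToFront-reflects-< σ z y≢z x≢z

  inversions-moveToFront : inversions σ σ′ ≤ toℕ (pos σ z)
  inversions-moveToFront = begin
    inversions σ σ′
      ≡⟨ inversions-∑ σ σ′ ⟩
    ∑[ x < n ] ∑[ y < n ] inverted σ σ′ x y
      ≡⟨ sum-cong-≗ {n} (λ x → ∑-single z (λ y → inverted-moveToFront x)) ⟩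
    ∑[ x < n ] inverted σ σ′ x z
      ≤⟨ ∑-mono-≤ (λ x → inverted-≤ˡ σ σ′ x z) ⟩
    ∑[ x < n ] precedes σ x z
      ≡⟨ ∑-predecessors σ z ⟩
    toℕ (pos σ z) ∎
    where open ≤-Reasoning

  inverted-moveToFront-≤ : (π : Perm n) {x y : Fin n} → x ≢ z → y ≢ z →
    inverted σ′ π x y ≤ inverted σ π x y
  inverted-moveToFront-≤ π {x} {y} x≢z y≢z with Finₚ.<-cmp (pos σ′ x) (pos σ′ y)
  ... | tri< σ′x<σ′y _ _ = ≤-reflexive (trans (inverted-yes σ′ π σ′x<σ′y)
                              (sym (inverted-yes σ π (moveToFront-reflects-< σ z x≢z y≢z σ′x<σ′y))))
  ... | tri≈ σ′x≮σ′y _ _ = ≤-trans (≤-reflexive (inverted-no σ′ π σ′x≮σ′y)) z≤n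
  ... | tri> σ′x≮σ′y _ _ = ≤-trans (≤-reflexive (inverted-no σ′ π σ′x≮σ′y)) z≤n

  precedes-moved : (π : Perm n) {y : Fin n} → y ≢ z →
    precedes π y z ≤ inverted σ π z y + precedes σ y z * precedes π y z
  precedes-moved π {y} y≢z with Finₚ.<-cmp (pos σ z) (pos σ y)
  ... | tri< σz<σy _ _ = ≤-trans (≤-reflexive (sym (inverted-yes σ π σz<σy))) (m≤m+n _ _)
  ... | tri≈ _ σz≡σy _ = contradiction (sym (pos-injective σ σz≡σy)) y≢z
  ... | tri> _ _ σy<σz = ≤-trans (≤-reflexive (sym common≡)) (m≤n+m _ _)
    where
    common≡ : precedes σ y z * precedes π y z ≡ precedes π y z
    common≡ = trans (cong (_* precedes π y z) (𝟙-yes (pos σ y <? pos σ z) σy<σz)) (+-identityʳ _)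

  inverted-moveToFront-pointwise : (π : Perm n) → ∀ x y →
    inverted σ′ π x y + 𝟙 (y ≟ z) * inverted σ π x z
      ≤ inverted σ π x y + 𝟙 (x ≟ z) * (precedes σ y z * precedes π y z)
  inverted-moveToFront-pointwise π x y with x ≟ z | y ≟ z
  ... | yes refl | yes refl =
    ≤-trans (≤-reflexive (cong₂ _+_ (inverted-irrefl σ′ π x) (cong (1 *_) (inverted-irrefl σ π x)))) z≤n
  ... | yes refl | no y≢z = begin
    inverted σ′ π x y + 0                                  ≡⟨ +-identityʳ _ ⟩
    inverted σ′ π x y                                      ≤⟨ inverted-≤ʳ σ′ π x y ⟩
    precedes π y x                                         ≤⟨ precedes-moved π y≢z ⟩
    inverted σ π x y + precedes σ y x * precedes π y x     ≡⟨ cong (inverted σ π x y +_) (*-identityˡ _) ⟨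
    inverted σ π x y + 1 * (precedes σ y x * precedes π y x) ∎
    where open ≤-Reasoning
  ... | no x≢z | yes refl = begin
    inverted σ′ π x y + 1 * inverted σ π x y
      ≡⟨ cong₂ _+_ (inverted-no σ′ π (moveToFront-first σ y x)) (*-identityˡ (inverted σ π x y)) ⟩
    inverted σ π x y
      ≡⟨ +-identityʳ _ ⟨
    inverted σ π x y + 0 ∎
    where open ≤-Reasoning
  ... | no x≢z | no y≢z = +-monoˡ-≤ 0 (inverted-moveToFront-≤ π x≢z y≢z)

  inversions-moveToFront-against : (π : Perm n) →
    inversions σ′ π + invertedPredecessors σ π z ≤ inversions σ π + commonPredecessors σ π z
  inversions-moveToFront-against π = begin
    inversions σ′ π + invertedPredecessors σ π z
      ≡⟨ cong₂ _+_ (inversions-∑ σ′ π) (sym (sum-cong-≗ {n} (λ x → ∑-indicator (λ _ → b x) z))) ⟩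
    ∑[ x < n ] ∑[ y < n ] inverted σ′ π x y + ∑[ x < n ] ∑[ y < n ] (𝟙 (y ≟ z) * b x)
      ≡⟨ ∑∑-distrib-+ (inverted σ′ π) (λ x y → 𝟙 (y ≟ z) * b x) ⟨
    ∑[ x < n ] ∑[ y < n ] (inverted σ′ π x y + 𝟙 (y ≟ z) * b x)
      ≤⟨ ∑-mono-≤ (λ x → ∑-mono-≤ (inverted-moveToFront-pointwise π x)) ⟩
    ∑[ x < n ] ∑[ y < n ] (inverted σ π x y + 𝟙 (x ≟ z) * a y)
      ≡⟨ ∑∑-distrib-+ (inverted σ π) (λ x y → 𝟙 (x ≟ z) * a y) ⟩
    ∑[ x < n ] ∑[ y < n ] inverted σ π x y + ∑[ x < n ] ∑[ y < n ] (𝟙 (x ≟ z) * a y)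
      ≡⟨ cong₂ _+_ (sym (inversions-∑ σ π)) (trans (∑-comm (λ x y → 𝟙 (x ≟ z) * a y))
                                                    (sum-cong-≗ {n} (λ y → ∑-indicator (λ _ → a y) z))) ⟩
    inversions σ π + commonPredecessors σ π z ∎
    where
    open ≤-Reasoning
    a b : Fin n → ℕ
    a y = precedes σ y z * precedes π y z
    b x = inverted σ π x z

-- a, i: our access and move cost; p = σ(z); A, B: common and inverted predecessors of z;
-- d, e, d′: d(σ, π), d(σ′, π), d(σ′, π′); c, k: the reference's access and move cost.
potential-step : ∀ {a i d′ e k d c A B p} →
  a ≤ suc p → i ≤ p → p ≡ A + B → d′ ≤ e + k → e + B ≤ d + A → A < c →
  a + i + 2 * d′ ≤ 4 * (c + k) + 2 * d
potential-step {a} {i} {d′} {e} {k} {d} {c} {A} {B} {p} a≤ i≤ p≡ d′≤ e≤ A<c = begin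
  a + i + 2 * d′
    ≤⟨ +-mono-≤ (+-mono-≤ a≤ i≤) (*-monoʳ-≤ 2 d′≤) ⟩
  suc p + p + 2 * (e + k)
    ≡⟨ cong (λ p → suc p + p + 2 * (e + k)) p≡ ⟩
  suc (A + B) + (A + B) + 2 * (e + k)
    ≡⟨ regroup₁ A B e k ⟩
  1 + 2 * A + 2 * (e + B) + 2 * k
    ≤⟨ +-monoˡ-≤ (2 * k) (+-monoʳ-≤ (1 + 2 * A) (*-monoʳ-≤ 2 e≤)) ⟩
  1 + 2 * A + 2 * (d + A) + 2 * k
    ≡⟨ regroup₂ A d k ⟩
  1 + 4 * A + 2 * k + 2 * d
    ≤⟨ +-monoˡ-≤ (2 * d) (+-mono-≤ 1+4A≤4c (*-monoˡ-≤ k (s≤s (s≤s (z≤n {2}))))) ⟩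
  4 * c + 4 * k + 2 * d
    ≡⟨ cong (_+ 2 * d) (*-distribˡ-+ 4 c k) ⟨
  4 * (c + k) + 2 * d ∎
  where
  open ≤-Reasoning
  regroup₁ : ∀ A B e k → suc (A + B) + (A + B) + 2 * (e + k) ≡ 1 + 2 * A + 2 * (e + B) + 2 * k
  regroup₁ = solve-∀
  regroup₂ : ∀ A d k → 1 + 2 * A + 2 * (d + A) + 2 * k ≡ 1 + 4 * A + 2 * k + 2 * d
  regroup₂ = solve-∀
  1+4A≤4c : 1 + 4 * A ≤ 4 * c
  1+4A≤4c = begin
    1 + 4 * A   ≤⟨ +-monoˡ-≤ (4 * A) (s≤s (z≤n {3})) ⟩
    4 + 4 * A   ≡⟨ *-suc 4 A ⟨
    4 * suc A   ≤⟨ *-monoʳ-≤ 4 A<c ⟩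
    4 * c       ∎

moveToFront-amortised : (σ π π′ : Perm n) (R : Subset n) {z : Fin n} → z ∈ˢ R →
  accessCost π R ≡ suc (toℕ (pos π z)) →
  accessCost σ R + inversions σ (moveToFront σ z) + 2 * inversions (moveToFront σ z) π′
    ≤ 4 * (accessCost π R + inversions π π′) + 2 * inversions σ π
moveToFront-amortised σ π π′ R {z} z∈R cost≡ =
  potential-step (accessCost-≤ σ R z∈R) (inversions-moveToFront σ z) (predecessors-split σ π z)
    (inversions-triangle (moveToFront σ z) π π′) (inversions-moveToFront-against σ z π)
    (subst (commonPredecessors σ π z <_) (sym cost≡) (s≤s (commonPredecessors-≤ σ π z)))

mtfRun-competitive : (σ π : Perm n) (Rs : Vec (Subset n) m) (ρs : Vec (Perm n) m) → AllNonempty Rs →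
  Σ (Vec (Perm n) m) λ off →
    MTFBased σ Rs off × totalCost σ Rs off ≤ 4 * totalCost π Rs ρs + 2 * inversions σ π
mtfRun-competitive σ π [] [] ne-[] = [] , mtf-[] , z≤n
mtfRun-competitive σ π (R ∷ Rs) (π′ ∷ ρs) (ne-∷ R≢∅ Rs≢∅)
  with z , z∈R , cost≡ ← accessCost-attained π R R≢∅
  with off , run , bound ← mtfRun-competitive (moveToFront σ z) π′ Rs ρs Rs≢∅
  = moveToFront σ z ∷ off , mtf-∷ (z , z∈R , moveToFront-correct σ z) run , cost-bound
  where
  open ≤-Reasoning
  σ′ = moveToFront σ z
  a = accessCost σ R
  i = inversions σ σ′
  d′ = inversions σ′ π′
  c = accessCost π R
  k = inversions π π′
  d = inversions σ π
  T = totalCost π′ Rs ρs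
  regroup : ∀ a i T d′ → a + i + (4 * T + 2 * d′) ≡ a + i + 2 * d′ + 4 * T
  regroup = solve-∀
  collect : ∀ c k d T → 4 * (c + k) + 2 * d + 4 * T ≡ 4 * (c + k + T) + 2 * d
  collect = solve-∀
  cost-bound : a + i + totalCost σ′ Rs off ≤ 4 * (c + k + T) + 2 * d
  cost-bound = begin
    a + i + totalCost σ′ Rs off          ≤⟨ +-monoʳ-≤ (a + i) bound ⟩
    a + i + (4 * T + 2 * d′)             ≡⟨ regroup a i T d′ ⟩
    a + i + 2 * d′ + 4 * T               ≤⟨ +-monoˡ-≤ (4 * T)
                                              (moveToFront-amortised σ π π′ R z∈R cost≡) ⟩
    4 * (c + k) + 2 * d + 4 * T          ≡⟨ collect c k d T ⟩
    4 * (c + k + T) + 2 * d              ∎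

allVecs : ∀ {A : Set} m → List A → List (Vec A m)
allVecs zero xs = List.[ [] ]
allVecs (suc m) xs = cartesianProductWith _∷_ xs (allVecs m xs)

∈-allVecs : ∀ {A : Set} {xs : List A} → (∀ a → a ∈ xs) → (v : Vec A m) → v ∈ allVecs m xs
∈-allVecs complete [] = here refl
∈-allVecs complete (a ∷ v) = ∈-cartesianProductWith⁺ _∷_ (complete a) (∈-allVecs complete v)

argmin-complete : ∀ {A : Set} (xs : List A) → (∀ a → a ∈ xs) → (f : A → ℕ) → A →
  Σ A λ a₀ → ∀ a → f a₀ ≤ f a
argmin-complete xs complete f a = argmin f a xs , λ b → All.lookup (f[argmin]≤f[xs] a xs) (complete b)

injective? : (v : Vec (Fin n) n) → Dec (∀ x y → lookup v x ≡ lookup v y → x ≡ y)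
injective? v = Finₚ.all? (λ x → Finₚ.all? (λ y → (lookup v x ≟ lookup v y) →-dec (x ≟ y)))

-- Non-injective codes decode to the identity, a junk value: only decode ∘ encode is used.
decode : Vec (Fin n) n → Perm n
decode v with injective? v
... | yes injective = record { pos = lookup v ; pos-injective = λ {x} {y} → injective x y }
... | no _ = record { pos = id ; pos-injective = id }

encode : Perm n → Vec (Fin n) n
encode π = tabulate (pos π)

decode-encode : (π : Perm n) → pos (decode (encode π)) ≗ pos π
decode-encode π x with injective? (encode π)
... | yes _ = lookup∘tabulate (pos π) x
... | no not-injective = contradiction encode-injective not-injective
  where
  encode-injective : ∀ x y → lookup (encode π) x ≡ lookup (encode π) y → x ≡ y
  encode-injective x y eq =
    pos-injective π (trans (sym (lookup∘tabulate (pos π) x)) (trans eq (lookup∘tabulate (pos π) y)))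

accessCost-cong : {π σ : Perm n} → pos π ≗ pos σ → (R : Subset n) → accessCost π R ≡ accessCost σ R
accessCost-cong {n} π≗σ R =
  foldr-cong (λ z acc → cong (λ p → if lookup R z then suc (toℕ p) ⊓ acc else acc) (π≗σ z)) refl (allFin n)

totalCost-cong : {π σ : Perm n} → pos π ≗ pos σ → (Rs : Vec (Subset n) m) {πs σs : Vec (Perm n) m} →
  Pointwise (λ π′ σ′ → pos π′ ≗ pos σ′) πs σs → totalCost π Rs πs ≡ totalCost σ Rs σs
totalCost-cong π≗σ [] [] = refl
totalCost-cong {π = π} {σ} π≗σ (R ∷ Rs) {π′ ∷ _} {σ′ ∷ _} (π′≗σ′ ∷ πs≗σs) =
  cong₂ _+_ (cong₂ _+_ (accessCost-cong {π = π} {σ} π≗σ R)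
                       (inversions-cong {π = π} {σ} {π′} {σ′} π≗σ π′≗σ′))
            (totalCost-cong π′≗σ′ Rs πs≗σs)

optimalRun : (π₀ : Perm n) (Rs : Vec (Subset n) m) →
  Σ (Vec (Perm n) m) λ opt → ∀ alg → totalCost π₀ Rs opt ≤ totalCost π₀ Rs alg
optimalRun {n} {m} π₀ Rs = map decode (proj₁ cheapest) , optimal
  where
  open ≤-Reasoning
  cost : Vec (Vec (Fin n) n) m → ℕ
  cost codes = totalCost π₀ Rs (map decode codes)
  cheapest = argmin-complete (allVecs m (allVecs n (allFin n))) (∈-allVecs (∈-allVecs ∈-allFin)) cost
                             (replicate m (Vec.allFin n))
  decode-encode-run : ∀ {k} (alg : Vec (Perm n) k) →
    Pointwise (λ π σ → pos π ≗ pos σ) (map decode (map encode alg)) alg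
  decode-encode-run [] = []
  decode-encode-run (π ∷ alg) = decode-encode π ∷ decode-encode-run alg
  optimal : ∀ alg → totalCost π₀ Rs (map decode (proj₁ cheapest)) ≤ totalCost π₀ Rs alg
  optimal alg = begin
    cost (proj₁ cheapest)                        ≤⟨ proj₂ cheapest (map encode alg) ⟩
    totalCost π₀ Rs (map decode (map encode alg)) ≡⟨ totalCost-cong (λ _ → refl) Rs
                                                                     (decode-encode-run alg) ⟩
    totalCost π₀ Rs alg                          ∎

lemma11 : (n m : ℕ) (π₀ : Perm n) (Rs : Vec (Subset n) m) → AllNonempty Rs →
    Σ (Vec (Perm n) m) λ off →
      MTFBased π₀ Rs off ×
      ((alg : Vec (Perm n) m) → totalCost π₀ Rs off ≤ 4 * totalCost π₀ Rs alg)
lemma11 n m π₀ Rs Rs≢∅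
  with opt , optimal ← optimalRun π₀ Rs
  with off , run , bound ← mtfRun-competitive π₀ π₀ Rs opt Rs≢∅
  = off , run , λ alg → begin
    totalCost π₀ Rs off                              ≤⟨ bound ⟩
    4 * totalCost π₀ Rs opt + 2 * inversions π₀ π₀   ≡⟨ cong (λ d → 4 * totalCost π₀ Rs opt + 2 * d)
                                                                (inversions-refl π₀) ⟩
    4 * totalCost π₀ Rs opt + 0                      ≡⟨ +-identityʳ _ ⟩
    4 * totalCost π₀ Rs opt                          ≤⟨ *-monoʳ-≤ 4 (optimal alg) ⟩
    4 * totalCost π₀ Rs alg                          ∎
  where open ≤-Reasoning
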